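{- Let $(W_r)_{r\in\mathbb{Z}}$ be a generalized Tribonacci sequence and $(T_r)_{r\in\mathbb{Z}}$ the Tribonacci sequence (definitions in the context). For all integers $a,b,c,d,e$, \[ \begin{split} &(T_{a-c}T_{c-b}T_{b-a}+T_{b-c}T_{c-a}T_{a-b})W_{d+e}\\ &=(T_{b-c}T_{c-a}T_{e-b}-T_{b-c}T_{c-b}T_{e-a}+T_{c-b}T_{b-a}T_{e-c})W_{d+a}\\ &\quad+(T_{a-c}T_{c-b}T_{e-a}-T_{a-c}T_{c-a}T_{e-b}+T_{c-a}T_{a-b}T_{e-c})W_{d+b}\\ &\quad+(T_{b-c}T_{a-b}T_{e-a}-T_{a-b}T_{b-a}T_{e-c}+T_{a-c}T_{b-a}T_{e-b})W_{d+c}. \end{split} \]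
   Context: Let $W_0,W_1,W_2$ be arbitrary integers, not all zero. The generalized Tribonacci numbers $(W_r)_{r\in\mathbb{Z}}$ are defined by $W_r=W_{r-1}+W_{r-2}+W_{r-3}$ for $r\ge 3$, and extended to negative indices by $W_{ -r}=W_{ -r+3}-W_{ -r+2}-W_{ -r+1}$ (so that $W_r=W_{r-1}+W_{r-2}+W_{r-3}$ holds for all $r\in\mathbb{Z}$). The Tribonacci numbers $(T_r)_{r\in\mathbb{Z}}$ are the special case $T_0=0$, $T_1=T_2=1$. -}

module Defs where

open import Data.Nat using (ℕ; zero; suc)
open import Data.Integer using (ℤ; +_; -[1+_]; _+_; _-_; 0ℤ; 1ℤ)
open import Data.Product using (_×_; _,_; proj₁)

Triple : Set
Triple = ℤ × ℤ × ℤ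

fwd : Triple → Triple
fwd (x , y , z) = (y , z , x + y + z)

-- backward step: (W_{-n}, W_{-n+1}, W_{-n+2}) ↦ (W_{-n-1}, W_{-n}, W_{-n+1})
-- using W_{-r} = W_{-r+3} - W_{-r+2} - W_{-r+1}
bwd : Triple → Triple
bwd (x , y , z) = (z - y - x , x , y)

iter : (Triple → Triple) → ℕ → Triple → Triple
iter f zero    t = t
iter f (suc n) t = f (iter f n t)

GTrib : ℤ → ℤ → ℤ → ℤ → ℤ
GTrib w0 w1 w2 (+ n)      = proj₁ (iter fwd n (w0 , w1 , w2))
GTrib w0 w1 w2 -[1+ n ]   = proj₁ (iter bwd (suc n) (w0 , w1 , w2))

Trib : ℤ → ℤ
Trib = GTrib 0ℤ 1ℤ 1ℤ

-- A generalized Tribonacci sequence satisfies W (x + y) = (W y , W (y + 1) , W (y + 2)) · E x for a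
-- coefficient vector E x ∈ ℤ³ depending only on x. Hence T (x - y) and W (d + x) are the pairings of
-- E x with the states of T at - y and of W at d, so the four rows
-- (T (x - a) , T (x - b) , T (x - c) , W (d + x)) for x = a, b, c, e are the images of E a, E b, E c,
-- E e under one linear map ℤ³ → ℤ⁴, and their 4 × 4 determinant vanishes. As T 0 = 0 the first three
-- rows have a zero diagonal, and expanding that determinant along its last column gives the identity.

module Submission where

open import Level using (Level; 0ℓ)
open import Data.Product using (_×_; _,_; proj₁)
open import Algebra.Bundles.Raw using (RawRing)

module Determinant {c ℓ : Level} (R : RawRing c ℓ) where
  open RawRing R

  infixl 6 _-_
  infixl 7 _·_

  _-_ : Carrier → Carrier → Carrier
  x - y = x + - y

  Vec₃ : Set c
  Vec₃ = Carrier × Carrier × Carrier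

  Vec₄ : Set c
  Vec₄ = Carrier × Carrier × Carrier × Carrier

  _·_ : Vec₃ → Vec₃ → Carrier
  (x₀ , x₁ , x₂) · (y₀ , y₁ , y₂) = x₀ * y₀ + x₁ * y₁ + x₂ * y₂

  det₃ : Vec₃ → Vec₃ → Vec₃ → Carrier
  det₃ (p₀ , p₁ , p₂) (q₀ , q₁ , q₂) (r₀ , r₁ , r₂) =
    p₀ * (q₁ * r₂ - q₂ * r₁) - p₁ * (q₀ * r₂ - q₂ * r₀) + p₂ * (q₀ * r₁ - q₁ * r₀)

  det₄ : Vec₄ → Vec₄ → Vec₄ → Vec₄ → Carrier
  det₄ (p₀ , p₁ , p₂ , p₃) (q₀ , q₁ , q₂ , q₃) (r₀ , r₁ , r₂ , r₃) (s₀ , s₁ , s₂ , s₃) =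
      s₃ * det₃ (p₀ , p₁ , p₂) (q₀ , q₁ , q₂) (r₀ , r₁ , r₂)
    - r₃ * det₃ (p₀ , p₁ , p₂) (q₀ , q₁ , q₂) (s₀ , s₁ , s₂)
    + q₃ * det₃ (p₀ , p₁ , p₂) (r₀ , r₁ , r₂) (s₀ , s₁ , s₂)
    - p₃ * det₃ (q₀ , q₁ , q₂) (r₀ , r₁ , r₂) (s₀ , s₁ , s₂)

  image : Vec₃ → Vec₃ → Vec₃ → Vec₃ → Vec₃ → Vec₄
  image α β γ ζ p = (α · p , β · p , γ · p , ζ · p)

-- Opened only now: inside Determinant, ℤ's _+_, _*_ and _-_ would clash with the ring's.
open import Defs
open import Data.Nat using (ℕ; zero; suc)
open import Data.Integer using (ℤ; _+_; _-_; _*_; 0ℤ; 1ℤ; -1ℤ; +_; -[1+_]; -_)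
open import Data.Integer.Properties
  using (+-*-commutativeRing; +-assoc; +-comm; +-identityˡ; +-inverseʳ; i-j≡0⇒i≡j)
open import Data.Integer.Tactic.RingSolver using (solve-∀; ring)
open import Algebra.Bundles using (CommutativeRing)
open import Function using (_∘_)
open import Relation.Binary.PropositionalEquality
  using (_≡_; refl; sym; trans; cong; cong₂; module ≡-Reasoning)
open import Relation.Nullary using (¬_)
import Tactic.RingSolver.NonReflective as NonReflective

open Determinant (CommutativeRing.rawRing +-*-commutativeRing) using (Vec₄; _·_; det₄; image)

open NonReflective ring using (solve; _⊜_; Κ; _⊕_; _⊗_; ⊝_; Expr)

-- The determinant formulas over the ring solver's expression syntax, so that identities about det₄
-- can be handed to the solver as they are stated.
expressionRawRing : ℕ → RawRing 0ℓ 0ℓ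
expressionRawRing n = record
  { Carrier = Expr ℤ n ; _≈_ = _≡_ ; _+_ = _⊕_ ; _*_ = _⊗_ ; -_ = ⊝_ ; 0# = Κ 0ℤ ; 1# = Κ 1ℤ }

module Expression (n : ℕ) = Determinant (expressionRawRing n)

det₄-cong : ∀ {p p′ q q′ r r′ s s′} → p ≡ p′ → q ≡ q′ → r ≡ r′ → s ≡ s′ →
  det₄ p q r s ≡ det₄ p′ q′ r′ s′
det₄-cong refl refl refl refl = refl

det₄-image≡0 : ∀ α β γ ζ p q r s →
  let f = image α β γ ζ in det₄ (f p) (f q) (f r) (f s) ≡ 0ℤ
det₄-image≡0 (α₀ , α₁ , α₂) (β₀ , β₁ , β₂) (γ₀ , γ₁ , γ₂) (ζ₀ , ζ₁ , ζ₂)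
             (p₀ , p₁ , p₂) (q₀ , q₁ , q₂) (r₀ , r₁ , r₂) (s₀ , s₁ , s₂) =
  solve 24 (λ α₀ α₁ α₂ β₀ β₁ β₂ γ₀ γ₁ γ₂ ζ₀ ζ₁ ζ₂ p₀ p₁ p₂ q₀ q₁ q₂ r₀ r₁ r₂ s₀ s₁ s₂ →
    let f = Expression.image 24 (α₀ , α₁ , α₂) (β₀ , β₁ , β₂) (γ₀ , γ₁ , γ₂) (ζ₀ , ζ₁ , ζ₂) in
    Expression.det₄ 24 (f (p₀ , p₁ , p₂)) (f (q₀ , q₁ , q₂)) (f (r₀ , r₁ , r₂)) (f (s₀ , s₁ , s₂))
      ⊜ Κ 0ℤ)
    refl α₀ α₁ α₂ β₀ β₁ β₂ γ₀ γ₁ γ₂ ζ₀ ζ₁ ζ₂ p₀ p₁ p₂ q₀ q₁ q₂ r₀ r₁ r₂ s₀ s₁ s₂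

det₄-hollow : (ra rb rc re : Vec₄) →
  let (maa , mab , mac , ua) = ra
      (mba , mbb , mbc , ub) = rb
      (mca , mcb , mcc , uc) = rc
      (mea , meb , mec , ue) = re
  in maa ≡ 0ℤ → mbb ≡ 0ℤ → mcc ≡ 0ℤ → det₄ ra rb rc re ≡ 0ℤ →
     (mac * mcb * mba + mbc * mca * mab) * ue
       ≡ (mbc * mca * meb - mbc * mcb * mea + mcb * mba * mec) * ua
       + (mac * mcb * mea - mac * mca * meb + mca * mab * mec) * ub
       + (mbc * mab * mea - mab * mba * mec + mac * mba * meb) * uc
det₄-hollow (_ , mab , mac , ua) (mba , _ , mbc , ub) (mca , mcb , _ , uc) (mea , meb , mec , ue)
  refl refl refl det≡0 = i-j≡0⇒i≡j _ _ (trans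
    (solve 13 (λ mab mac mba mbc mca mcb mea meb mec ua ub uc ue →
      (mac ⊗ mcb ⊗ mba ⊕ mbc ⊗ mca ⊗ mab) ⊗ ue
        ⊖ ((mbc ⊗ mca ⊗ meb ⊖ mbc ⊗ mcb ⊗ mea ⊕ mcb ⊗ mba ⊗ mec) ⊗ ua
         ⊕ (mac ⊗ mcb ⊗ mea ⊖ mac ⊗ mca ⊗ meb ⊕ mca ⊗ mab ⊗ mec) ⊗ ub
         ⊕ (mbc ⊗ mab ⊗ mea ⊖ mab ⊗ mba ⊗ mec ⊕ mac ⊗ mba ⊗ meb) ⊗ uc)
      ⊜ Expression.det₄ 13 (Κ 0ℤ , mab , mac , ua) (mba , Κ 0ℤ , mbc , ub) (mca , mcb , Κ 0ℤ , uc)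
                           (mea , meb , mec , ue))
      refl mab mac mba mbc mca mcb mea meb mec ua ub uc ue)
    det≡0)
  where open Expression 13 using () renaming (_-_ to _⊖_)

shift : ℤ → Triple → Triple
shift (+ n)    = iter fwd n
shift -[1+ n ] = iter bwd (suc n)

GTrib≡head-shift : ∀ w₀ w₁ w₂ n → GTrib w₀ w₁ w₂ n ≡ proj₁ (shift n (w₀ , w₁ , w₂))
GTrib≡head-shift w₀ w₁ w₂ (+ n)    = refl
GTrib≡head-shift w₀ w₁ w₂ -[1+ n ] = refl

bwd∘fwd : ∀ t → bwd (fwd t) ≡ t
bwd∘fwd (x , y , z) = cong (_, y , z) (identity x y z)
  where
  identity : ∀ x y z → x + y + z - z - y ≡ x
  identity = solve-∀

fwd∘bwd : ∀ t → fwd (bwd t) ≡ t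
fwd∘bwd (x , y , z) = cong (λ u → x , y , u) (identity x y z)
  where
  identity : ∀ x y z → z - y - x + x + y ≡ z
  identity = solve-∀

shift-suc : ∀ m t → shift (1ℤ + m) t ≡ fwd (shift m t)
shift-suc (+ n)        t = refl
shift-suc -[1+ zero ]  t = sym (fwd∘bwd t)
shift-suc -[1+ suc n ] t = sym (fwd∘bwd _)

shift-pred : ∀ m t → shift (-1ℤ + m) t ≡ bwd (shift m t)
shift-pred (+ zero)  t = refl
shift-pred (+ suc n) t = sym (bwd∘fwd _)
shift-pred -[1+ n ]  t = refl

shift-+ : ∀ m n t → shift (m + n) t ≡ shift m (shift n t)
shift-+ (+ zero)       n t = cong (λ i → shift i t) (+-identityˡ n)
shift-+ (+ suc k)      n t = begin
  shift (1ℤ + + k + n) t         ≡⟨ cong (λ i → shift i t) (+-assoc 1ℤ (+ k) n) ⟩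
  shift (1ℤ + (+ k + n)) t       ≡⟨ shift-suc (+ k + n) t ⟩
  fwd (shift (+ k + n) t)        ≡⟨ cong fwd (shift-+ (+ k) n t) ⟩
  fwd (shift (+ k) (shift n t))  ∎
  where open ≡-Reasoning
shift-+ -[1+ zero ]    n t = shift-pred n t
shift-+ -[1+ suc k ]   n t = begin
  shift (-1ℤ + -[1+ k ] + n) t      ≡⟨ cong (λ i → shift i t) (+-assoc -1ℤ -[1+ k ] n) ⟩
  shift (-1ℤ + (-[1+ k ] + n)) t    ≡⟨ shift-pred (-[1+ k ] + n) t ⟩
  bwd (shift (-[1+ k ] + n) t)      ≡⟨ cong bwd (shift-+ -[1+ k ] n t) ⟩
  bwd (shift -[1+ k ] (shift n t))  ∎
  where open ≡-Reasoning

lincomb : ℤ → ℤ → ℤ → Triple → Triple → Triple → Triple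
lincomb k l m (p₀ , p₁ , p₂) (q₀ , q₁ , q₂) (r₀ , r₁ , r₂) =
  (k * p₀ + l * q₀ + m * r₀ , k * p₁ + l * q₁ + m * r₁ , k * p₂ + l * q₂ + m * r₂)

Linear : (Triple → Triple) → Set
Linear f = ∀ k l m p q r → f (lincomb k l m p q r) ≡ lincomb k l m (f p) (f q) (f r)

fwd-linear : Linear fwd
fwd-linear k l m (p₀ , p₁ , p₂) (q₀ , q₁ , q₂) (r₀ , r₁ , r₂) =
  cong (λ u → _ , _ , u) (identity k l m p₀ p₁ p₂ q₀ q₁ q₂ r₀ r₁ r₂)
  where
  identity : ∀ k l m p₀ p₁ p₂ q₀ q₁ q₂ r₀ r₁ r₂ →
    k * p₀ + l * q₀ + m * r₀ + (k * p₁ + l * q₁ + m * r₁) + (k * p₂ + l * q₂ + m * r₂)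
      ≡ k * (p₀ + p₁ + p₂) + l * (q₀ + q₁ + q₂) + m * (r₀ + r₁ + r₂)
  identity = solve-∀

bwd-linear : Linear bwd
bwd-linear k l m (p₀ , p₁ , p₂) (q₀ , q₁ , q₂) (r₀ , r₁ , r₂) =
  cong (_, _ , _) (identity k l m p₀ p₁ p₂ q₀ q₁ q₂ r₀ r₁ r₂)
  where
  identity : ∀ k l m p₀ p₁ p₂ q₀ q₁ q₂ r₀ r₁ r₂ →
    k * p₂ + l * q₂ + m * r₂ - (k * p₁ + l * q₁ + m * r₁) - (k * p₀ + l * q₀ + m * r₀)
      ≡ k * (p₂ - p₁ - p₀) + l * (q₂ - q₁ - q₀) + m * (r₂ - r₁ - r₀)
  identity = solve-∀

iter-linear : ∀ {f} → Linear f → ∀ n → Linear (iter f n)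
iter-linear     f-linear zero    k l m p q r = refl
iter-linear {f} f-linear (suc n) k l m p q r =
  trans (cong f (iter-linear f-linear n k l m p q r)) (f-linear k l m _ _ _)

shift-linear : ∀ n → Linear (shift n)
shift-linear (+ n)    = iter-linear fwd-linear n
shift-linear -[1+ n ] = iter-linear bwd-linear (suc n)

e₀ : Triple
e₀ = (1ℤ , 0ℤ , 0ℤ)

e₁ : Triple
e₁ = (0ℤ , 1ℤ , 0ℤ)

e₂ : Triple
e₂ = (0ℤ , 0ℤ , 1ℤ)

lincomb-basis : ∀ x y z → lincomb x y z e₀ e₁ e₂ ≡ (x , y , z)
lincomb-basis x y z = cong₂ _,_ (first x y z) (cong₂ _,_ (second x y z) (third x y z))
  where
  first : ∀ x y z → x * 1ℤ + y * 0ℤ + z * 0ℤ ≡ x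
  first = solve-∀
  second : ∀ x y z → x * 0ℤ + y * 1ℤ + z * 0ℤ ≡ y
  second = solve-∀
  third : ∀ x y z → x * 0ℤ + y * 0ℤ + z * 1ℤ ≡ z
  third = solve-∀

coefficients : ℤ → Triple
coefficients n = (proj₁ (shift n e₀) , proj₁ (shift n e₁) , proj₁ (shift n e₂))

head-shift : ∀ n t → proj₁ (shift n t) ≡ t · coefficients n
head-shift n (x , y , z) = begin
  proj₁ (shift n (x , y , z))               ≡⟨ cong (proj₁ ∘ shift n) (sym (lincomb-basis x y z)) ⟩
  proj₁ (shift n (lincomb x y z e₀ e₁ e₂))  ≡⟨ cong proj₁ (shift-linear n x y z e₀ e₁ e₂) ⟩
  (x , y , z) · coefficients n              ∎
  where open ≡-Reasoning

GTrib-+ : ∀ w₀ w₁ w₂ m n → GTrib w₀ w₁ w₂ (m + n) ≡ shift n (w₀ , w₁ , w₂) · coefficients m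
GTrib-+ w₀ w₁ w₂ m n = begin
  GTrib w₀ w₁ w₂ (m + n)                    ≡⟨ GTrib≡head-shift w₀ w₁ w₂ (m + n) ⟩
  proj₁ (shift (m + n) (w₀ , w₁ , w₂))      ≡⟨ cong proj₁ (shift-+ m n (w₀ , w₁ , w₂)) ⟩
  proj₁ (shift m (shift n (w₀ , w₁ , w₂)))  ≡⟨ head-shift m (shift n (w₀ , w₁ , w₂)) ⟩
  shift n (w₀ , w₁ , w₂) · coefficients m   ∎
  where open ≡-Reasoning

tribState : ℤ → Triple
tribState n = shift n (0ℤ , 1ℤ , 1ℤ)

Trib-difference : ∀ x y → Trib (x - y) ≡ tribState (- y) · coefficients x
Trib-difference x y = GTrib-+ 0ℤ 1ℤ 1ℤ x (- y)

Trib-diagonal : ∀ x → Trib (x - x) ≡ 0ℤ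
Trib-diagonal x = cong Trib (+-inverseʳ x)

GTrib-sum : ∀ w₀ w₁ w₂ d x → GTrib w₀ w₁ w₂ (d + x) ≡ shift d (w₀ , w₁ , w₂) · coefficients x
GTrib-sum w₀ w₁ w₂ d x = trans (cong (GTrib w₀ w₁ w₂) (+-comm d x)) (GTrib-+ w₀ w₁ w₂ x d)

module TribonacciRows (W₀ W₁ W₂ a b c d : ℤ) where

  row : ℤ → Vec₄
  row x = (Trib (x - a) , Trib (x - b) , Trib (x - c) , GTrib W₀ W₁ W₂ (d + x))

  linearRow : Triple → Vec₄
  linearRow = image (tribState (- a)) (tribState (- b)) (tribState (- c)) (shift d (W₀ , W₁ , W₂))

  row≡linearRow : ∀ x → row x ≡ linearRow (coefficients x)
  row≡linearRow x =
    cong₂ _,_ (Trib-difference x a) (cong₂ _,_ (Trib-difference x b)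
      (cong₂ _,_ (Trib-difference x c) (GTrib-sum W₀ W₁ W₂ d x)))

  det₄-rows≡0 : ∀ e → det₄ (row a) (row b) (row c) (row e) ≡ 0ℤ
  det₄-rows≡0 e = trans
    (det₄-cong (row≡linearRow a) (row≡linearRow b) (row≡linearRow c) (row≡linearRow e))
    (det₄-image≡0 (tribState (- a)) (tribState (- b)) (tribState (- c)) (shift d (W₀ , W₁ , W₂))
                  (coefficients a) (coefficients b) (coefficients c) (coefficients e))

theorem1 : (W₀ W₁ W₂ : ℤ) → ¬ (W₀ ≡ 0ℤ × W₁ ≡ 0ℤ × W₂ ≡ 0ℤ) →
    (a b c d e : ℤ) →
    (Trib (a - c) * Trib (c - b) * Trib (b - a) + Trib (b - c) * Trib (c - a) * Trib (a - b))
      * GTrib W₀ W₁ W₂ (d + e)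
    ≡ (Trib (b - c) * Trib (c - a) * Trib (e - b) - Trib (b - c) * Trib (c - b) * Trib (e - a)
        + Trib (c - b) * Trib (b - a) * Trib (e - c)) * GTrib W₀ W₁ W₂ (d + a)
      + (Trib (a - c) * Trib (c - b) * Trib (e - a) - Trib (a - c) * Trib (c - a) * Trib (e - b)
        + Trib (c - a) * Trib (a - b) * Trib (e - c)) * GTrib W₀ W₁ W₂ (d + b)
      + (Trib (b - c) * Trib (a - b) * Trib (e - a) - Trib (a - b) * Trib (b - a) * Trib (e - c)
        + Trib (a - c) * Trib (b - a) * Trib (e - b)) * GTrib W₀ W₁ W₂ (d + c)
-- The identity holds for every W.
theorem1 W₀ W₁ W₂ _ a b c d e =
  det₄-hollow (row a) (row b) (row c) (row e) (Trib-diagonal a) (Trib-diagonal b) (Trib-diagonal c)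
    (det₄-rows≡0 e)
  where open TribonacciRows W₀ W₁ W₂ a b c d
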